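{- Let $n\in\mathbb{P}$. Let $B^J=\{u\in B_n\mid u(1)<u(2)<\dots<u(n)\}$ and $D^J=\{u\in D_n\mid u(1)<u(2)<\dots<u(n)\}$. Then $$\sum_{u\in B^J}p^{\operatorname{N}_1(u)}q^{\operatorname{N}_1(u)+\operatorname{N}_2(u)}=\sum_{S\subseteq[n]}p^{|S|}q^{\sum_{i\in S}i}=\prod_{i=1}^n(1+pq^i)=(-pq;q)_n,$$ and $$\sum_{u\in D^J}p^{\operatorname{N}_1(u)+\epsilon(u)}q^{\operatorname{N}_2(u)}=\sum_{S\subseteq[n-1]}p^{|S|}q^{\sum_{i\in S}i}=\prod_{i=1}^{n-1}(1+pq^i)=(-pq;q)_{n-1}.$$
   Context: $B_n$ is the group of bijections $\beta$ of $[-n,n]\setminus\{0\}$ with $\beta(-i)=-\beta(i)$, in window notation $[\beta(1),\dots,\beta(n)]$; $D_n\subseteq B_n$ is the subgroup of those with an even number of negative entries among $\beta(1),\dots,\beta(n)$. $\operatorname{N}_1(\beta)=|\{i\in[n]:\beta(i)<0\}|$, $\operatorname{N}_2(\beta)=|\{\{i,j\}\subseteq[n],i\ne j:\beta(i)+\beta(j)<0\}|$, and $\epsilon(\beta)=-1$ if $1\notin\{\beta(1),\dots,\beta(n)\}$, $\epsilon(\beta)=0$ otherwise. $(a;q)_0=1$, $(a;q)_n=(1-a)(1-aq)\cdots(1-aq^{n-1})$. -}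

module Defs where

open import Level using (Level)
open import Data.Bool using (Bool; true; false; if_then_else_)
open import Data.Nat as ℕ using (ℕ; zero; suc; _%_)
open import Data.Integer as ℤ using (ℤ; +_; -[1+_]; ∣_∣; 0ℤ; 1ℤ; -1ℤ)
open import Data.List using (List; []; _∷_; [_]; map; concatMap; filter; length; upTo; _++_; foldr)
open import Data.List.Relation.Unary.Any using (any?)
open import Data.List.Relation.Unary.Linked using (Linked; linked?)
open import Data.List.Relation.Unary.AllPairs using (allPairs?)
open import Relation.Nullary using (¬?)
open import Relation.Nullary.Decidable using (does)
open import Relation.Binary.PropositionalEquality using (_≡_)
open import Algebra.Bundles using (CommutativeRing)

-- Signed permutations in window notation: a window is the list
-- [β(1),…,β(n)] of integers.

allLists : {A : Set} → List A → ℕ → List (List A)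
allLists xs zero    = [ [] ]
allLists xs (suc k) = concatMap (λ x → map (x ∷_) (allLists xs k)) xs

vals : ℕ → List ℤ
vals n = map (λ i → -[1+ i ]) (upTo n) ++ map (λ i → + suc i) (upTo n)

-- β is determined by its window; β is a bijection of [-n,n]\{0} with
-- β(-i) = -β(i) iff the window entries lie in [-n,n]\{0} and the
-- absolute values |β(1)|,…,|β(n)| are pairwise distinct.
Bn : ℕ → List (List ℤ)
Bn n = filter (λ w → allPairs? (λ x y → ¬? (∣ x ∣ ℕ.≟ ∣ y ∣)) w)
              (allLists (vals n) n)

N1 : List ℤ → ℕ
N1 w = length (filter (ℤ._<? 0ℤ) w)

N2 : List ℤ → ℕ
N2 []       = 0
N2 (x ∷ xs) = length (filter (λ y → (x ℤ.+ y) ℤ.<? 0ℤ) xs) ℕ.+ N2 xs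

eps : List ℤ → ℤ
eps w = if does (any? (ℤ._≟ 1ℤ) w) then 0ℤ else -1ℤ

Dn : ℕ → List (List ℤ)
Dn n = filter (λ w → N1 w % 2 ℕ.≟ 0) (Bn n)

BJ : ℕ → List (List ℤ)
BJ n = filter (linked? ℤ._<?_) (Bn n)

DJ : ℕ → List (List ℤ)
DJ n = filter (linked? ℤ._<?_) (Dn n)

-- Subsets S ⊆ [k], encoded as characteristic lists [1∈S?, …, k∈S?]

subsets : ℕ → List (List Bool)
subsets k = allLists (true ∷ false ∷ []) k

card : List Bool → ℕ
card []          = 0
card (true ∷ S)  = suc (card S)
card (false ∷ S) = card S

-- Σ_{i ∈ S} i, where the list entry at position j (counted from k) says
-- whether j ∈ S; use with k = 1.
weightFrom : ℕ → List Bool → ℕ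
weightFrom k []          = 0
weightFrom k (true ∷ S)  = k ℕ.+ weightFrom (suc k) S
weightFrom k (false ∷ S) = weightFrom (suc k) S

weight : List Bool → ℕ
weight S = weightFrom 1 S

-- Polynomial identities in p, q are stated by evaluation in an
-- arbitrary commutative ring.

module _ {c ℓ : Level} (R : CommutativeRing c ℓ) where
  open CommutativeRing R

  pow : Carrier → ℕ → Carrier
  pow x zero    = 1#
  pow x (suc k) = x * pow x k

  sumR : List Carrier → Carrier
  sumR = foldr _+_ 0#

  prodR : List Carrier → Carrier
  prodR = foldr _*_ 1#

  qPoch : Carrier → Carrier → ℕ → Carrier
  qPoch a q k = prodR (map (λ j → 1# - a * pow q j) (upTo k))

  subsetSum : Carrier → Carrier → ℕ → Carrier
  subsetSum p q k = sumR (map (λ S → pow p (card S) * pow q (weight S)) (subsets k))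

  prodTerm : Carrier → Carrier → ℕ → Carrier
  prodTerm p q k = prodR (map (λ j → 1# + p * pow q (suc j)) (upTo k))

  BJsum : Carrier → Carrier → ℕ → Carrier
  BJsum p q n = sumR (map (λ u → pow p (N1 u) * pow q (N1 u ℕ.+ N2 u)) (BJ n))

  -- Σ_{u ∈ D^J} p^{N₁(u)+ε(u)} q^{N₂(u)}   (N₁(u)+ε(u) ≥ 0 is converted to ℕ)
  DJsum : Carrier → Carrier → ℕ → Carrier
  DJsum p q n = sumR (map (λ u → pow p ∣ + N1 u ℤ.+ eps u ∣ * pow q (N2 u)) (DJ n))

module Submission where

-- The entry of
-- absolute value n must be the first entry (-n) or the last one (n), and
-- removing it leaves a window for B_{n-1}; this yields an explicit
-- duplicate-free enumeration W n of B^J (pigeonhole excludes windows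
-- avoiding ±n).  Prepending -n multiplies p^{N₁} q^{N₁+N₂} by p q^n and
-- appending n changes nothing, so the B^J sum F_n satisfies
-- F_n = (1 + p q^n) F_{n-1}.  For D^J the same split is run on the even and
-- odd parts of W n at once (prepending flips the parity of N₁), using that
-- N₁ + ε grows by one under prepending; this gives (-pq;q)_{n-1}.  The
-- subset sum factors by deciding membership of each element, and the
-- q-Pochhammer form is a termwise rewriting.

open import Defs
open import Level using (Level)
open import Data.Nat using (ℕ; _≤_; _∸_)
open import Data.Product using (_×_)
open import Algebra.Bundles using (CommutativeRing)

open import Data.Bool using (Bool; true; false; not; _∨_; _xor_; if_then_else_)
open import Data.Bool.Properties using (not-involutive; not-distribˡ-xor; not-distribʳ-xor)
open import Data.Empty using (⊥-elim)
open import Data.Integer as ℤ using (ℤ; +_; -[1+_]; ∣_∣; 0ℤ; 1ℤ; -1ℤ)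
import Data.Integer.Properties as ℤP
import Data.Nat as ℕ
open import Data.Nat using (zero; suc; z≤n; s≤s; _%_)
import Data.Nat.Properties as ℕP
open import Data.List using (List; []; _∷_; [_]; map; filter; length; upTo; _++_; _∷ʳ_)
import Data.List.Properties as ListP
open import Data.List.Membership.Propositional using (_∈_; find)
open import Data.List.Membership.Propositional.Properties using (∈-++⁺ˡ; ∈-++⁺ʳ; ∈-++⁻; ∈-map⁺; ∈-map⁻; map∷⁻; ∈-concatMap⁺; ∈-concatMap⁻; ∈-filter⁺; ∈-filter⁻; ∈-upTo⁺; ∈-upTo⁻)
open import Data.List.Membership.Propositional.Properties.WithK using (unique∧set⇒bag)
open import Data.List.Relation.Binary.BagAndSetEquality using (∼bag⇒↭)
open import Data.List.Relation.Binary.Permutation.Propositional using (↭⇒↭ₛ′)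
import Data.List.Relation.Binary.Permutation.Propositional.Properties as Perm
import Data.List.Relation.Binary.Permutation.Setoid.Properties as PermSetoid
open import Data.List.Relation.Binary.Subset.Propositional using (_⊆_)
open import Data.List.Relation.Unary.All as All using (All; []; _∷_)
import Data.List.Relation.Unary.All.Properties as AllP
open import Data.List.Relation.Unary.Any as Any using (here; there; any?)
open import Data.List.Relation.Unary.AllPairs as AllPairs using (AllPairs; []; _∷_)
import Data.List.Relation.Unary.AllPairs.Properties as AllPairsP
open import Data.List.Relation.Unary.Linked using (Linked)
import Data.List.Relation.Unary.Linked.Properties as LinkedP
open import Data.List.Relation.Unary.Unique.Propositional using (Unique)
import Data.List.Relation.Unary.Unique.Propositional.Properties as UniqueP
open import Data.Product using (_,_; proj₁; proj₂)
open import Data.Sum using (_⊎_; inj₁; inj₂)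
open import Function.Bundles using (mk⇔)
open import Relation.Nullary using (¬_; does)
open import Relation.Unary using (Decidable)
open import Relation.Binary.PropositionalEquality as ≡ using (_≡_; _≢_)
import Relation.Binary.Reasoning.Setoid as SetoidReasoning
import Algebra.Properties.CommutativeSemigroup as CommutativeSemigroupProperties
import Algebra.Properties.Ring as RingProperties

module ListSums {c ℓ : Level} (R : CommutativeRing c ℓ) where
  open CommutativeRing R

  sumOf : {A : Set} → (A → Carrier) → List A → Carrier
  sumOf f xs = sumR R (map f xs)

  sumOf-++ : {A : Set} (f : A → Carrier) (xs ys : List A) →
    sumOf f (xs ++ ys) ≈ sumOf f xs + sumOf f ys
  sumOf-++ f []       ys = sym (+-identityˡ _)
  sumOf-++ f (x ∷ xs) ys = trans (+-congˡ (sumOf-++ f xs ys)) (sym (+-assoc _ _ _))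

  sumOf-map : {A B : Set} (f : B → Carrier) (g : A → B) (xs : List A) →
    sumOf f (map g xs) ≡ sumOf (λ x → f (g x)) xs
  sumOf-map f g xs = ≡.cong (sumR R) (≡.sym (ListP.map-∘ xs))

  sumOf-cong : {A : Set} {f g : A → Carrier} (xs : List A) →
    (∀ {x} → x ∈ xs → f x ≈ g x) → sumOf f xs ≈ sumOf g xs
  sumOf-cong []       f≈g = refl
  sumOf-cong (x ∷ xs) f≈g = +-cong (f≈g (here ≡.refl)) (sumOf-cong xs (λ x∈ → f≈g (there x∈)))

  sumOf-scale : {A : Set} (f : A → Carrier) (a : Carrier) (xs : List A) →
    sumOf (λ x → a * f x) xs ≈ a * sumOf f xs
  sumOf-scale f a []       = sym (zeroʳ a)
  sumOf-scale f a (x ∷ xs) = trans (+-congˡ (sumOf-scale f a xs)) (sym (distribˡ a _ _))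

  sumOf-filter : {A : Set} {P : A → Set} (P? : Decidable P) (f : A → Carrier) (xs : List A) →
    sumOf f (filter P? xs) ≈ sumOf (λ x → if does (P? x) then f x else 0#) xs
  sumOf-filter P? f []       = refl
  sumOf-filter P? f (x ∷ xs) with does (P? x)
  ... | true  = +-congˡ (sumOf-filter P? f xs)
  ... | false = trans (sumOf-filter P? f xs) (sym (+-identityˡ _))

  sumOf-setEq : {A : Set} (f : A → Carrier) {xs ys : List A} →
    Unique xs → Unique ys → xs ⊆ ys → ys ⊆ xs → sumOf f xs ≈ sumOf f ys
  sumOf-setEq f ux uy xs⊆ys ys⊆xs =
    PermSetoid.foldr-commMonoid setoid +-isCommutativeMonoid
      (↭⇒↭ₛ′ isEquivalence (Perm.map⁺ f (∼bag⇒↭ (unique∧set⇒bag ux uy (mk⇔ xs⊆ys ys⊆xs)))))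

  prodR-∷ʳ : (xs : List Carrier) (x : Carrier) → prodR R (xs ∷ʳ x) ≈ prodR R xs * x
  prodR-∷ʳ []       x = trans (*-identityʳ x) (sym (*-identityˡ x))
  prodR-∷ʳ (y ∷ xs) x = trans (*-congˡ (prodR-∷ʳ xs x)) (sym (*-assoc _ _ _))

  prodOf-cong : {A : Set} {f g : A → Carrier} (xs : List A) →
    (∀ x → f x ≈ g x) → prodR R (map f xs) ≈ prodR R (map g xs)
  prodOf-cong []       f≈g = refl
  prodOf-cong (x ∷ xs) f≈g = *-cong (f≈g x) (prodOf-cong xs f≈g)

  pow-+ : ∀ x a b → pow R x (a ℕ.+ b) ≈ pow R x a * pow R x b
  pow-+ x zero    b = sym (*-identityˡ _)
  pow-+ x (suc a) b = trans (*-congˡ (pow-+ x a b)) (sym (*-assoc _ _ _))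

module Windows where
  open ≡ using (refl; cong; sym; trans; subst)

  data Entry (m : ℕ) : ℤ → Set where
    neg : ∀ {i} → i ℕ.< m → Entry m -[1+ i ]
    pos : ∀ {i} → i ℕ.< m → Entry m (+ suc i)

  entry-weaken : ∀ {m y} → Entry m y → Entry (suc m) y
  entry-weaken (neg i<m) = neg (ℕP.m<n⇒m<1+n i<m)
  entry-weaken (pos i<m) = pos (ℕP.m<n⇒m<1+n i<m)

  entry-abs : ∀ {m y} → Entry m y → ∣ y ∣ ≤ m
  entry-abs (neg i<m) = i<m
  entry-abs (pos i<m) = i<m

  entry-abs≢ : ∀ {m y} → Entry m y → ∣ y ∣ ≢ suc m
  entry-abs≢ e eq = ℕP.1+n≰n (subst (_≤ _) eq (entry-abs e))

  entry-lower : ∀ {m y} → Entry m y → -[1+ m ] ℤ.< y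
  entry-lower (neg i<m) = ℤ.-<- i<m
  entry-lower (pos _)   = ℤ.-<+

  entry-upper : ∀ {m y} → Entry m y → y ℤ.≤ + m
  entry-upper (neg _)   = ℤ.-≤+
  entry-upper (pos i<m) = ℤ.+≤+ i<m

  entry-below-top : ∀ {m y} → Entry m y → y ℤ.< + suc m
  entry-below-top e = ℤP.≤-<-trans (entry-upper e) (ℤ.+<+ (ℕP.n<1+n _))

  entry-split : ∀ {m y} → Entry (suc m) y → y ≡ -[1+ m ] ⊎ y ≡ + suc m ⊎ Entry m y
  entry-split (neg i<1+m) with ℕP.m<1+n⇒m<n∨m≡n i<1+m
  ... | inj₁ i<m  = inj₂ (inj₂ (neg i<m))
  ... | inj₂ refl = inj₁ refl
  entry-split (pos i<1+m) with ℕP.m<1+n⇒m<n∨m≡n i<1+m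
  ... | inj₁ i<m  = inj₂ (inj₂ (pos i<m))
  ... | inj₂ refl = inj₂ (inj₁ refl)

  entry-shrink : ∀ {m y} → Entry (suc m) y → ∣ y ∣ ≢ suc m → Entry m y
  entry-shrink e ≢top with entry-split e
  ... | inj₁ refl        = ⊥-elim (≢top refl)
  ... | inj₂ (inj₁ refl) = ⊥-elim (≢top refl)
  ... | inj₂ (inj₂ e′)   = e′

  Before : ℤ → ℤ → Set
  Before x y = x ℤ.< y × ∣ x ∣ ≢ ∣ y ∣

  IsBJ : ℕ → List ℤ → Set
  IsBJ m u = length u ≡ m × All (Entry m) u × AllPairs Before u

  length-∷ʳ : {A : Set} (xs : List A) (x : A) → length (xs ∷ʳ x) ≡ suc (length xs)
  length-∷ʳ []       x = refl
  length-∷ʳ (y ∷ xs) x = cong suc (length-∷ʳ xs x)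

  allPairs-++⁻ˡ : {A : Set} {P : A → A → Set} (xs : List A) {ys : List A} →
    AllPairs P (xs ++ ys) → AllPairs P xs
  allPairs-++⁻ˡ []       _          = []
  allPairs-++⁻ˡ (x ∷ xs) (px ∷ pxs) = AllP.++⁻ˡ xs px ∷ allPairs-++⁻ˡ xs pxs

  entry⇒∈vals : ∀ {m y} → Entry m y → y ∈ vals m
  entry⇒∈vals (neg i<m) = ∈-++⁺ˡ (∈-map⁺ -[1+_] (∈-upTo⁺ i<m))
  entry⇒∈vals {m} (pos i<m) = ∈-++⁺ʳ (map -[1+_] (upTo m)) (∈-map⁺ (λ i → + suc i) (∈-upTo⁺ i<m))

  ∈vals⇒entry : ∀ {m y} → y ∈ vals m → Entry m y
  ∈vals⇒entry {m} y∈ with ∈-++⁻ (map -[1+_] (upTo m)) y∈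
  ... | inj₁ y∈neg with ∈-map⁻ -[1+_] y∈neg
  ...   | i , i∈ , refl = neg (∈-upTo⁻ i∈)
  ∈vals⇒entry y∈ | inj₂ y∈pos with ∈-map⁻ (λ i → + suc i) y∈pos
  ...   | i , i∈ , refl = pos (∈-upTo⁻ i∈)

  vals-unique : ∀ m → Unique (vals m)
  vals-unique m = UniqueP.++⁺ (UniqueP.map⁺ neg-inj (UniqueP.upTo⁺ m))
                              (UniqueP.map⁺ pos-inj (UniqueP.upTo⁺ m)) disjoint
    where
    neg-inj : ∀ {i j} → -[1+ i ] ≡ -[1+ j ] → i ≡ j
    neg-inj refl = refl
    pos-inj : ∀ {i j} → + suc i ≡ + suc j → i ≡ j
    pos-inj refl = refl
    disjoint : ∀ {y} → ¬ (y ∈ map -[1+_] (upTo m) × y ∈ map (λ i → + suc i) (upTo m))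
    disjoint (y∈neg , y∈pos) with ∈-map⁻ -[1+_] y∈neg | ∈-map⁻ (λ i → + suc i) y∈pos
    ... | _ , _ , refl | _ , _ , ()

  ∈allLists⇒ : {A : Set} {xs : List A} (k : ℕ) {w : List A} →
    w ∈ allLists xs k → length w ≡ k × All (_∈ xs) w
  ∈allLists⇒ zero (here refl) = refl , []
  ∈allLists⇒ {xs = xs} (suc k) w∈ with find (∈-concatMap⁻ (λ z → map (z ∷_) (allLists xs k)) {xs = xs} w∈)
  ... | x , x∈ , w∈x with map∷⁻ w∈x
  ...   | w′ , w′∈ , refl with ∈allLists⇒ k w′∈
  ...     | len , all∈ = cong suc len , x∈ ∷ all∈

  ⇒∈allLists : {A : Set} {xs w : List A} → All (_∈ xs) w → w ∈ allLists xs (length w)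
  ⇒∈allLists []          = here refl
  ⇒∈allLists {xs = xs} {x ∷ w} (x∈ ∷ all∈) =
    ∈-concatMap⁺ (λ z → map (z ∷_) (allLists xs (length w)))
      (Any.map (λ { refl → ∈-map⁺ (x ∷_) (⇒∈allLists all∈) }) x∈)

  allLists-unique : {A : Set} {xs : List A} (k : ℕ) → Unique xs → Unique (allLists xs k)
  allLists-unique zero    _    = [] ∷ []
  allLists-unique {xs = xs} (suc k) uxs =
    UniqueP.concat⁺ (AllP.map⁺ (All.tabulate (λ _ → UniqueP.map⁺ ∷-injectiveʳ (allLists-unique k uxs))))
                    (AllPairsP.map⁺ (AllPairs.map disjoint uxs))
    where
    ∷-injectiveʳ : ∀ {x} {ws vs : List _} → x ∷ ws ≡ x ∷ vs → ws ≡ vs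
    ∷-injectiveʳ refl = refl
    disjoint : ∀ {x y} → x ≢ y → ∀ {v} → ¬ (v ∈ map (x ∷_) (allLists xs k) × v ∈ map (y ∷_) (allLists xs k))
    disjoint x≢y (v∈x , v∈y) with map∷⁻ v∈x | map∷⁻ v∈y
    ... | _ , _ , refl | _ , _ , refl = x≢y refl

  DistinctAbs : ℤ → ℤ → Set
  DistinctAbs x y = ∣ x ∣ ≢ ∣ y ∣

  ∈Bn⇒ : ∀ m {u} → u ∈ Bn m → length u ≡ m × All (Entry m) u × AllPairs DistinctAbs u
  ∈Bn⇒ m u∈ with ∈-filter⁻ _ {xs = allLists (vals m) m} u∈
  ... | u∈all , distinct with ∈allLists⇒ m u∈all
  ...   | len , all∈ = len , All.map ∈vals⇒entry all∈ , distinct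

  isBJ⇒∈Bn : ∀ m {u} → IsBJ m u → u ∈ Bn m
  isBJ⇒∈Bn m {u} (len , entries , before) =
    ∈-filter⁺ _ (subst (λ k → u ∈ allLists (vals m) k) len (⇒∈allLists (All.map entry⇒∈vals entries)))
                (AllPairs.map proj₂ before)

  increasing : ∀ {u} → AllPairs Before u → Linked ℤ._<_ u
  increasing before = LinkedP.AllPairs⇒Linked (AllPairs.map proj₁ before)

  increasing-Bn⇒isBJ : ∀ m {u} → u ∈ Bn m → Linked ℤ._<_ u → IsBJ m u
  increasing-Bn⇒isBJ m u∈ linked with ∈Bn⇒ m u∈
  ... | len , entries , distinct = len , entries , AllPairs.zip (LinkedP.Linked⇒AllPairs ℤP.<-trans linked , distinct)

  isBJ⇒∈BJ : ∀ m {u} → IsBJ m u → u ∈ BJ m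
  isBJ⇒∈BJ m bj = ∈-filter⁺ _ (isBJ⇒∈Bn m bj) (increasing (proj₂ (proj₂ bj)))

  ∈BJ⇒isBJ : ∀ m {u} → u ∈ BJ m → IsBJ m u
  ∈BJ⇒isBJ m u∈ with ∈-filter⁻ _ {xs = Bn m} u∈
  ... | u∈Bn , linked = increasing-Bn⇒isBJ m u∈Bn linked

  even? : Decidable (λ u → N1 u % 2 ≡ 0)
  even? u = N1 u % 2 ℕ.≟ 0

  isBJ⇒∈DJ : ∀ m {u} → IsBJ m u → N1 u % 2 ≡ 0 → u ∈ DJ m
  isBJ⇒∈DJ m bj even = ∈-filter⁺ _ (∈-filter⁺ _ (isBJ⇒∈Bn m bj) even) (increasing (proj₂ (proj₂ bj)))

  ∈DJ⇒isBJ : ∀ m {u} → u ∈ DJ m → IsBJ m u × N1 u % 2 ≡ 0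
  ∈DJ⇒isBJ m u∈ with ∈-filter⁻ _ {xs = Dn m} u∈
  ... | u∈Dn , linked with ∈-filter⁻ _ {xs = Bn m} u∈Dn
  ...   | u∈Bn , even = increasing-Bn⇒isBJ m u∈Bn linked , even

  BJ-unique : ∀ m → Unique (BJ m)
  BJ-unique m = UniqueP.filter⁺ _ (UniqueP.filter⁺ _ (allLists-unique m (vals-unique m)))

  DJ-unique : ∀ m → Unique (DJ m)
  DJ-unique m = UniqueP.filter⁺ _ (UniqueP.filter⁺ _ (UniqueP.filter⁺ _ (allLists-unique m (vals-unique m))))

  -- The enumeration of B^J behind the product formula: an increasing
  -- window of B_{m+1} either starts with -(m+1) or ends with m+1.
  W : ℕ → List (List ℤ)
  W zero    = [ [] ]
  W (suc m) = map (-[1+ m ] ∷_) (W m) ++ map (_∷ʳ + suc m) (W m)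

  prepend-isBJ : ∀ m {w} → IsBJ m w → IsBJ (suc m) (-[1+ m ] ∷ w)
  prepend-isBJ m (len , entries , before) =
    cong suc len ,
    neg (ℕP.n<1+n m) ∷ All.map entry-weaken entries ,
    All.map (λ e → entry-lower e , λ eq → entry-abs≢ e (sym eq)) entries ∷ before

  append-isBJ : ∀ m {w} → IsBJ m w → IsBJ (suc m) (w ∷ʳ + suc m)
  append-isBJ m {w} (len , entries , before) =
    trans (length-∷ʳ w _) (cong suc len) ,
    AllP.++⁺ (All.map entry-weaken entries) (pos (ℕP.n<1+n m) ∷ []) ,
    AllPairsP.++⁺ before ([] ∷ []) (All.map (λ e → (entry-below-top e , entry-abs≢ e) ∷ []) entries)

  W-sound : ∀ m {u} → u ∈ W m → IsBJ m u
  W-sound zero (here refl) = refl , [] , []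
  W-sound (suc m) u∈ with ∈-++⁻ (map (-[1+ m ] ∷_) (W m)) u∈
  ... | inj₁ u∈first with map∷⁻ u∈first
  ...   | w , w∈ , refl = prepend-isBJ m (W-sound m w∈)
  W-sound (suc m) u∈ | inj₂ u∈last with ∈-map⁻ (_∷ʳ + suc m) u∈last
  ...   | w , w∈ , refl = append-isBJ m (W-sound m w∈)

  W-unique : ∀ m → Unique (W m)
  W-unique zero    = [] ∷ []
  W-unique (suc m) =
    UniqueP.++⁺ (UniqueP.map⁺ ∷-injectiveʳ (W-unique m))
                (UniqueP.map⁺ (λ {ws} {vs} → ListP.∷ʳ-injectiveˡ ws vs) (W-unique m)) disjoint
    where
    ∷-injectiveʳ : ∀ {ws vs : List ℤ} → -[1+ m ] ∷ ws ≡ -[1+ m ] ∷ vs → ws ≡ vs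
    ∷-injectiveʳ refl = refl
    -- m+1 occurs in every window of the second half, in none of the first
    disjoint : ∀ {u} → ¬ (u ∈ map (-[1+ m ] ∷_) (W m) × u ∈ map (_∷ʳ + suc m) (W m))
    disjoint (u∈first , u∈last) with map∷⁻ u∈first | ∈-map⁻ (_∷ʳ + suc m) u∈last
    ... | w , w∈ , refl | v , _ , eq with subst (+ suc m ∈_) (sym eq) (∈-++⁺ʳ v (here refl))
    ...   | there top∈w = entry-abs≢ (All.lookup (proj₁ (proj₂ (W-sound m w∈))) top∈w) refl

  data Shape (m : ℕ) : List ℤ → Set where
    inner : ∀ {u} → All (Entry m) u → Shape m u
    first : ∀ {u} → All (Entry m) u → Shape m (-[1+ m ] ∷ u)
    last  : ∀ {u} → All (Entry m) u → Shape m (u ∷ʳ + suc m)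

  nothing-above : ∀ {m u} → All (Entry m) u → All (Before (+ m)) u → u ≡ []
  nothing-above []      _              = refl
  nothing-above (e ∷ _) ((m<y , _) ∷ _) = ⊥-elim (ℤP.<⇒≱ m<y (entry-upper e))

  shape : ∀ m {u} → All (Entry (suc m)) u → AllPairs Before u → Shape m u
  shape m []       []       = inner []
  shape m (e ∷ es) (b ∷ bs) with entry-split e
  ... | inj₁ refl        = first (All.zipWith (λ (e′ , b′) → entry-shrink e′ (λ eq → proj₂ b′ (sym eq))) (es , b))
  ... | inj₂ (inj₁ refl) rewrite nothing-above es b = last []
  ... | inj₂ (inj₂ e′) with shape m es bs
  ...   | inner es′ = inner (e′ ∷ es′)
  ...   | first _   = ⊥-elim (ℤP.<-asym (proj₁ (All.head b)) (entry-lower e′))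
  ...   | last es′  = last (e′ ∷ es′)

  bounded : ∀ m {u} → All (Entry m) u → AllPairs Before u → length u ≤ m
  bounded zero    []            _ = z≤n
  bounded zero    (neg () ∷ _) _
  bounded zero    (pos () ∷ _) _
  bounded (suc m) es bs with shape m es bs
  ... | inner es′      = ℕP.m≤n⇒m≤1+n (bounded m es′ bs)
  ... | first es′      = s≤s (bounded m es′ (AllPairs.tail bs))
  ... | last {u} es′   = subst (_≤ suc m) (sym (length-∷ʳ u _)) (s≤s (bounded m es′ (allPairs-++⁻ˡ u bs)))

  W-complete : ∀ m {u} → IsBJ m u → u ∈ W m
  W-complete zero {[]}    _        = here refl
  W-complete zero {_ ∷ _} (() , _)
  W-complete (suc m) (len , es , bs) with shape m es bs
  ... | inner es′    = ⊥-elim (ℕP.1+n≰n (subst (_≤ m) len (bounded m es′ bs)))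
  ... | first es′    = ∈-++⁺ˡ (∈-map⁺ (-[1+ m ] ∷_) (W-complete m (ℕP.suc-injective len , es′ , AllPairs.tail bs)))
  ... | last {u} es′ = ∈-++⁺ʳ _ (∈-map⁺ (_∷ʳ + suc m)
                         (W-complete m (ℕP.suc-injective (trans (sym (length-∷ʳ u _)) len) , es′ , allPairs-++⁻ˡ u bs)))

  BJ⊆W : ∀ m → BJ m ⊆ W m
  BJ⊆W m u∈ = W-complete m (∈BJ⇒isBJ m u∈)

  W⊆BJ : ∀ m → W m ⊆ BJ m
  W⊆BJ m u∈ = isBJ⇒∈BJ m (W-sound m u∈)

  DJ⊆evenW : ∀ m → DJ m ⊆ filter even? (W m)
  DJ⊆evenW m u∈ with ∈DJ⇒isBJ m u∈
  ... | bj , even = ∈-filter⁺ even? (W-complete m bj) even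

  evenW⊆DJ : ∀ m → filter even? (W m) ⊆ DJ m
  evenW⊆DJ m u∈ with ∈-filter⁻ even? {xs = W m} u∈
  ... | u∈W , even = isBJ⇒∈DJ m (W-sound m u∈W) even

module Statistics where
  open Windows
  open ≡ using (refl; cong; cong₂; sym; trans)

  prepend-sum-negative : ∀ {m y} → Entry m y → -[1+ m ] ℤ.+ y ℤ.< 0ℤ
  prepend-sum-negative {m} {y} e =
    ≡.subst (-[1+ m ] ℤ.+ y ℤ.<_) (ℤP.+-inverseˡ (+ suc m)) (ℤP.+-monoʳ-< -[1+ m ] (entry-below-top e))

  append-sum-nonnegative : ∀ {m y} → Entry m y → ¬ (y ℤ.+ + suc m ℤ.< 0ℤ)
  append-sum-nonnegative {m} {y} e =
    ℤP.<-asym (≡.subst (ℤ._< y ℤ.+ + suc m) (ℤP.+-inverseˡ (+ suc m)) (ℤP.+-monoˡ-< (+ suc m) (entry-lower e)))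

  N1-append : ∀ w n → N1 (w ∷ʳ + n) ≡ N1 w
  N1-append w n = begin
    length (filter (ℤ._<? 0ℤ) (w ++ [ + n ]))  ≡⟨ cong length (ListP.filter-++ (ℤ._<? 0ℤ) w [ + n ]) ⟩
    length (filter (ℤ._<? 0ℤ) w ++ [])          ≡⟨ cong length (ListP.++-identityʳ (filter (ℤ._<? 0ℤ) w)) ⟩
    N1 w                                        ∎
    where open ≡.≡-Reasoning

  N2-prepend : ∀ x w → All (λ y → x ℤ.+ y ℤ.< 0ℤ) w → N2 (x ∷ w) ≡ length w ℕ.+ N2 w
  N2-prepend x w negative = cong (λ v → length v ℕ.+ N2 w) (ListP.filter-all (λ y → (x ℤ.+ y) ℤ.<? 0ℤ) negative)

  N2-append : ∀ w x → All (λ y → ¬ (y ℤ.+ x ℤ.< 0ℤ)) w → N2 (w ∷ʳ x) ≡ N2 w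
  N2-append []      x _ = refl
  N2-append (y ∷ w) x (y+x≥0 ∷ nonneg) = cong₂ ℕ._+_ pairs-with-y (N2-append w x nonneg)
    where
    P? : Decidable (λ z → (y ℤ.+ z) ℤ.< 0ℤ)
    P? z = (y ℤ.+ z) ℤ.<? 0ℤ
    pairs-with-y : length (filter P? (w ∷ʳ x)) ≡ length (filter P? w)
    pairs-with-y = begin
      length (filter P? (w ++ [ x ]))          ≡⟨ cong length (ListP.filter-++ P? w [ x ]) ⟩
      length (filter P? w ++ filter P? [ x ])  ≡⟨ cong (λ v → length (filter P? w ++ v)) (ListP.filter-reject P? {xs = []} y+x≥0) ⟩
      length (filter P? w ++ [])               ≡⟨ cong length (ListP.++-identityʳ (filter P? w)) ⟩
      length (filter P? w) ∎
      where open ≡.≡-Reasoning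

  hasOne : List ℤ → Bool
  hasOne u = does (any? (ℤ._≟ 1ℤ) u)

  hasOne-append : ∀ w k → hasOne (w ∷ʳ + suc (suc k)) ≡ hasOne w
  hasOne-append []      k = refl
  hasOne-append (y ∷ w) k = cong (does (y ℤ.≟ 1ℤ) ∨_) (hasOne-append w k)

  eps-append : ∀ w k → eps (w ∷ʳ + suc (suc k)) ≡ eps w
  eps-append w k = cong (λ b → if b then 0ℤ else -1ℤ) (hasOne-append w k)

  dExp : List ℤ → ℕ
  dExp u = ∣ + N1 u ℤ.+ eps u ∣

  W-one-or-negative : ∀ k {w} → w ∈ W (suc k) → hasOne w ≡ true ⊎ 1 ≤ N1 w
  W-one-or-negative zero    (here refl)         = inj₂ (s≤s z≤n)
  W-one-or-negative zero    (there (here refl)) = inj₁ refl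
  W-one-or-negative (suc k) w∈ with ∈-++⁻ (map (-[1+ suc k ] ∷_) (W (suc k))) w∈
  ... | inj₁ w∈first with map∷⁻ w∈first
  ...   | _ , _ , refl = inj₂ (s≤s z≤n)
  W-one-or-negative (suc k) w∈ | inj₂ w∈last with ∈-map⁻ (_∷ʳ + suc (suc k)) w∈last
  ...   | w , w∈ , refl rewrite hasOne-append w k | N1-append w (suc (suc k)) = W-one-or-negative k w∈

  dExp-prepend : ∀ m w → hasOne w ≡ true ⊎ 1 ≤ N1 w → dExp (-[1+ m ] ∷ w) ≡ suc (dExp w)
  dExp-prepend m w = exponent-suc (hasOne w) (N1 w)
    where
    exponent-suc : ∀ b n → b ≡ true ⊎ 1 ≤ n →
      ∣ + suc n ℤ.+ (if b then 0ℤ else -1ℤ) ∣ ≡ suc ∣ + n ℤ.+ (if b then 0ℤ else -1ℤ) ∣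
    exponent-suc true  n       _        = refl
    exponent-suc false (suc n) _        = refl
    exponent-suc false zero    (inj₁ ())
    exponent-suc false zero    (inj₂ ())

  evenN1 : List ℤ → Bool
  evenN1 u = does (even? u)

  evenN1-prepend : ∀ m w → evenN1 (-[1+ m ] ∷ w) ≡ not (evenN1 w)
  evenN1-prepend m w = even-suc (N1 w)
    where
    even-suc : ∀ a → does (suc a % 2 ℕ.≟ 0) ≡ not (does (a % 2 ℕ.≟ 0))
    even-suc zero    = refl
    even-suc (suc a) = sym (trans (cong not (even-suc a)) (not-involutive _))

module WeightedSums {c ℓ : Level} (R : CommutativeRing c ℓ) (p q : CommutativeRing.Carrier R) where
  open CommutativeRing R
  open ListSums R
  open Windows
  open Statistics
  open SetoidReasoning setoid
  open CommutativeSemigroupProperties *-commutativeSemigroup using (interchange)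
  open CommutativeSemigroupProperties ℕP.+-commutativeSemigroup using () renaming (x∙yz≈y∙xz to ℕ+-left-comm)
  open RingProperties ring using (-‿distribˡ-*; -‿involutive)

  monomial-shift : ∀ a b j → pow R p (suc a) * pow R q (j ℕ.+ b) ≈ (p * pow R q j) * (pow R p a * pow R q b)
  monomial-shift a b j = trans (*-congˡ (pow-+ q j b)) (interchange p (pow R p a) (pow R q j) (pow R q b))

  scale-add : ∀ a X → a * X + X ≈ (1# + a) * X
  scale-add a X = begin
    a * X + X        ≈⟨ +-comm _ _ ⟩
    X + a * X        ≈⟨ +-congʳ (sym (*-identityˡ X)) ⟩
    1# * X + a * X   ≈⟨ sym (distribʳ X 1# a) ⟩
    (1# + a) * X     ∎

  factorAt : ℕ → Carrier
  factorAt e = 1# + p * pow R q e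

  prodTerm-suc : ∀ m → prodTerm R p q (suc m) ≈ prodTerm R p q m * factorAt (suc m)
  prodTerm-suc m = begin
    prodR R (map f (upTo (suc m)))       ≡⟨ ≡.cong (λ l → prodR R (map f l)) (≡.sym (ListP.upTo-∷ʳ m)) ⟩
    prodR R (map f (upTo m ∷ʳ m))        ≡⟨ ≡.cong (prodR R) (ListP.map-++ f (upTo m) [ m ]) ⟩
    prodR R (map f (upTo m) ∷ʳ f m)      ≈⟨ prodR-∷ʳ (map f (upTo m)) (f m) ⟩
    prodTerm R p q m * factorAt (suc m)  ∎
    where
    f : ℕ → Carrier
    f j = factorAt (suc j)

  prodTerm-grow : ∀ m {X Y} → X ≈ prodTerm R p q m → Y ≈ prodTerm R p q m →
    (p * pow R q (suc m)) * X + Y ≈ prodTerm R p q (suc m)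
  prodTerm-grow m {X} {Y} X≈ Y≈ = begin
    a * X + Y               ≈⟨ +-cong (*-congˡ X≈) Y≈ ⟩
    a * P + P               ≈⟨ scale-add a P ⟩
    (1# + a) * P            ≈⟨ *-comm _ _ ⟩
    P * factorAt (suc m)    ≈⟨ sym (prodTerm-suc m) ⟩
    prodTerm R p q (suc m)  ∎
    where
    a P : Carrier
    a = p * pow R q (suc m)
    P = prodTerm R p q m

  sumW-split : (f g : List ℤ → Carrier) (a : Carrier) (m : ℕ) →
    (∀ {w} → w ∈ W m → f (-[1+ m ] ∷ w) ≈ a * g w) →
    (∀ {w} → w ∈ W m → f (w ∷ʳ + suc m) ≡ f w) →
    sumOf f (W (suc m)) ≈ a * sumOf g (W m) + sumOf f (W m)
  sumW-split f g a m prepend append = begin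
    sumOf f (map (-[1+ m ] ∷_) (W m) ++ map (_∷ʳ + suc m) (W m))
      ≈⟨ sumOf-++ f (map (-[1+ m ] ∷_) (W m)) (map (_∷ʳ + suc m) (W m)) ⟩
    sumOf f (map (-[1+ m ] ∷_) (W m)) + sumOf f (map (_∷ʳ + suc m) (W m))
      ≡⟨ ≡.cong₂ _+_ (sumOf-map f _ (W m)) (sumOf-map f _ (W m)) ⟩
    sumOf (λ w → f (-[1+ m ] ∷ w)) (W m) + sumOf (λ w → f (w ∷ʳ + suc m)) (W m)
      ≈⟨ +-cong (sumOf-cong (W m) prepend) (sumOf-cong (W m) (λ w∈ → reflexive (append w∈))) ⟩
    sumOf (λ w → a * g w) (W m) + sumOf f (W m)
      ≈⟨ +-congʳ (sumOf-scale g a (W m)) ⟩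
    a * sumOf g (W m) + sumOf f (W m) ∎

  weightB : List ℤ → Carrier
  weightB u = pow R p (N1 u) * pow R q (N1 u ℕ.+ N2 u)

  -- prepending -(m+1) adds one negative entry and m negative pair sums
  weightB-prepend : ∀ m {w} → w ∈ W m → weightB (-[1+ m ] ∷ w) ≈ (p * pow R q (suc m)) * weightB w
  weightB-prepend m {w} w∈ with W-sound m w∈
  ... | len , entries , _ = begin
    pow R p (suc (N1 w)) * pow R q (suc (N1 w) ℕ.+ N2 (-[1+ m ] ∷ w))
      ≡⟨ ≡.cong (λ e → pow R p (suc (N1 w)) * pow R q e) exponent ⟩
    pow R p (suc (N1 w)) * pow R q (suc m ℕ.+ (N1 w ℕ.+ N2 w))
      ≈⟨ monomial-shift (N1 w) (N1 w ℕ.+ N2 w) (suc m) ⟩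
    (p * pow R q (suc m)) * weightB w ∎
    where
    exponent : suc (N1 w) ℕ.+ N2 (-[1+ m ] ∷ w) ≡ suc m ℕ.+ (N1 w ℕ.+ N2 w)
    exponent rewrite N2-prepend -[1+ m ] w (All.map prepend-sum-negative entries) | len =
      ≡.cong suc (ℕ+-left-comm (N1 w) m (N2 w))

  weightB-append : ∀ m {w} → w ∈ W m → weightB (w ∷ʳ + suc m) ≡ weightB w
  weightB-append m {w} w∈ rewrite N1-append w (suc m)
    | N2-append w (+ suc m) (All.map append-sum-nonnegative (proj₁ (proj₂ (W-sound m w∈)))) = ≡.refl

  sumW-weightB : ∀ m → sumOf weightB (W m) ≈ prodTerm R p q m
  sumW-weightB zero    = trans (+-identityʳ _) (*-identityˡ _)
  sumW-weightB (suc m) =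
    trans (sumW-split weightB weightB _ m (weightB-prepend m) (weightB-append m))
          (prodTerm-grow m (sumW-weightB m) (sumW-weightB m))

  -- B^J and W m list the same windows without repetition
  BJsum≈prodTerm : ∀ m → BJsum R p q m ≈ prodTerm R p q m
  BJsum≈prodTerm m =
    trans (sumOf-setEq weightB (BJ-unique m) (W-unique m) (BJ⊆W m) (W⊆BJ m)) (sumW-weightB m)

  weightD : List ℤ → Carrier
  weightD u = pow R p (dExp u) * pow R q (N2 u)

  weightD-prepend : ∀ k {w} → w ∈ W (suc k) → weightD (-[1+ suc k ] ∷ w) ≈ (p * pow R q (suc k)) * weightD w
  weightD-prepend k {w} w∈ with W-sound (suc k) w∈
  ... | len , entries , _ = begin
    pow R p (dExp (-[1+ suc k ] ∷ w)) * pow R q (N2 (-[1+ suc k ] ∷ w))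
      ≡⟨ ≡.cong₂ (λ a b → pow R p a * pow R q b) (dExp-prepend (suc k) w (W-one-or-negative k w∈))
           (≡.trans (N2-prepend -[1+ suc k ] w (All.map prepend-sum-negative entries)) (≡.cong (ℕ._+ N2 w) len)) ⟩
    pow R p (suc (dExp w)) * pow R q (suc k ℕ.+ N2 w)
      ≈⟨ monomial-shift (dExp w) (N2 w) (suc k) ⟩
    (p * pow R q (suc k)) * weightD w ∎

  -- appending m+1 changes neither N₁, N₂ nor ε (as m+1 ≠ 1)
  weightD-append : ∀ k {w} → w ∈ W (suc k) → weightD (w ∷ʳ + suc (suc k)) ≡ weightD w
  weightD-append k {w} w∈ rewrite N1-append w (suc (suc k)) | eps-append w k
    | N2-append w (+ suc (suc k)) (All.map append-sum-nonnegative (proj₁ (proj₂ (W-sound (suc k) w∈)))) = ≡.refl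

  -- the part of weightD carried by windows with N₁ odd (odd = true) or even (odd = false)
  part : Bool → List ℤ → Carrier
  part odd u = if odd xor evenN1 u then weightD u else 0#

  if-scale : ∀ b {a x y} → x ≈ a * y → (if b then x else 0#) ≈ a * (if b then y else 0#)
  if-scale true  x≈ay = x≈ay
  if-scale false _    = sym (zeroʳ _)

  part-prepend : ∀ k odd {w} → w ∈ W (suc k) →
    part odd (-[1+ suc k ] ∷ w) ≈ (p * pow R q (suc k)) * part (not odd) w
  part-prepend k odd {w} w∈ = begin
    (if odd xor evenN1 (-[1+ suc k ] ∷ w) then weightD (-[1+ suc k ] ∷ w) else 0#)
      ≡⟨ ≡.cong (λ b → if b then weightD (-[1+ suc k ] ∷ w) else 0#) parity-flip ⟩
    (if not odd xor evenN1 w then weightD (-[1+ suc k ] ∷ w) else 0#)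
      ≈⟨ if-scale (not odd xor evenN1 w) (weightD-prepend k w∈) ⟩
    (p * pow R q (suc k)) * part (not odd) w ∎
    where
    parity-flip : odd xor evenN1 (-[1+ suc k ] ∷ w) ≡ not odd xor evenN1 w
    parity-flip = ≡.trans (≡.cong (odd xor_) (evenN1-prepend (suc k) w))
                    (≡.trans (≡.sym (not-distribʳ-xor odd (evenN1 w))) (not-distribˡ-xor odd (evenN1 w)))

  part-append : ∀ k odd {w} → w ∈ W (suc k) → part odd (w ∷ʳ + suc (suc k)) ≡ part odd w
  part-append k odd {w} w∈ =
    ≡.cong₂ (λ n x → if odd xor does (n % 2 ℕ.≟ 0) then x else 0#) (N1-append w (suc (suc k))) (weightD-append k w∈)

  sumW-part : ∀ k odd → sumOf (part odd) (W (suc k)) ≈ prodTerm R p q k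
  sumW-part zero    false = trans (+-identityˡ _) (trans (+-identityʳ _) (*-identityˡ _))
  sumW-part zero    true  = trans (+-cong (*-identityˡ _) (+-identityʳ _)) (+-identityʳ _)
  sumW-part (suc k) odd   =
    trans (sumW-split (part odd) (part (not odd)) _ (suc k) (part-prepend k odd) (part-append k odd))
          (prodTerm-grow k (sumW-part k (not odd)) (sumW-part k odd))

  -- D^J is the even part of W (k+1)
  DJsum≈prodTerm : ∀ k → DJsum R p q (suc k) ≈ prodTerm R p q k
  DJsum≈prodTerm k = begin
    sumOf weightD (DJ (suc k))
      ≈⟨ sumOf-setEq weightD (DJ-unique (suc k)) (UniqueP.filter⁺ even? (W-unique (suc k))) (DJ⊆evenW (suc k)) (evenW⊆DJ (suc k)) ⟩
    sumOf weightD (filter even? (W (suc k)))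
      ≈⟨ sumOf-filter even? weightD (W (suc k)) ⟩
    sumOf (part false) (W (suc k))
      ≈⟨ sumW-part k false ⟩
    prodTerm R p q k ∎

  subsetSumFrom : ℕ → ℕ → Carrier
  subsetSumFrom j k = sumOf (λ S → pow R p (card S) * pow R q (weightFrom j S)) (subsets k)

  upTo-suc : {a : Level} {A : Set a} (f : ℕ → A) (k : ℕ) → map f (upTo (suc k)) ≡ f 0 ∷ map (λ i → f (suc i)) (upTo k)
  upTo-suc f k = ≡.trans (ListP.map-upTo f (suc k)) (≡.cong (f 0 ∷_) (≡.sym (ListP.map-upTo (λ i → f (suc i)) k)))

  -- choosing whether j belongs to S gives the factor 1 + p q^j
  subsetSumFrom≈ : ∀ j k → subsetSumFrom j k ≈ prodR R (map (λ i → factorAt (j ℕ.+ i)) (upTo k))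
  subsetSumFrom≈ j zero    = trans (+-identityʳ _) (*-identityˡ _)
  subsetSumFrom≈ j (suc k) = begin
    sumOf F (map (true ∷_) L ++ (map (false ∷_) L ++ []))
      ≈⟨ trans (sumOf-++ F (map (true ∷_) L) _) (+-congˡ (trans (sumOf-++ F (map (false ∷_) L) []) (+-identityʳ _))) ⟩
    sumOf F (map (true ∷_) L) + sumOf F (map (false ∷_) L)
      ≡⟨ ≡.cong₂ _+_ (sumOf-map F (true ∷_) L) (sumOf-map F (false ∷_) L) ⟩
    sumOf (λ S → F (true ∷ S)) L + subsetSumFrom (suc j) k
      ≈⟨ +-congʳ (sumOf-cong L (λ {S} _ → monomial-shift (card S) (weightFrom (suc j) S) j)) ⟩
    sumOf (λ S → (p * pow R q j) * F′ S) L + subsetSumFrom (suc j) k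
      ≈⟨ +-congʳ (sumOf-scale F′ _ L) ⟩
    (p * pow R q j) * subsetSumFrom (suc j) k + subsetSumFrom (suc j) k
      ≈⟨ scale-add _ _ ⟩
    factorAt j * subsetSumFrom (suc j) k
      ≈⟨ *-cong (reflexive (≡.cong factorAt (≡.sym (ℕP.+-identityʳ j)))) (subsetSumFrom≈ (suc j) k) ⟩
    factorAt (j ℕ.+ 0) * prodR R (map (λ i → factorAt (suc j ℕ.+ i)) (upTo k))
      ≡⟨ ≡.cong (λ l → factorAt (j ℕ.+ 0) * prodR R l) (ListP.map-cong (λ i → ≡.cong factorAt (≡.sym (ℕP.+-suc j i))) (upTo k)) ⟩
    prodR R (factorAt (j ℕ.+ 0) ∷ map (λ i → factorAt (j ℕ.+ suc i)) (upTo k))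
      ≡⟨ ≡.cong (prodR R) (≡.sym (upTo-suc (λ i → factorAt (j ℕ.+ i)) k)) ⟩
    prodR R (map (λ i → factorAt (j ℕ.+ i)) (upTo (suc k))) ∎
    where
    L : List (List Bool)
    L = subsets k
    F F′ : List Bool → Carrier
    F  S = pow R p (card S) * pow R q (weightFrom j S)
    F′ S = pow R p (card S) * pow R q (weightFrom (suc j) S)

  subsetSum≈prodTerm : ∀ k → subsetSum R p q k ≈ prodTerm R p q k
  subsetSum≈prodTerm = subsetSumFrom≈ 1

  prodTerm≈qPoch : ∀ k → prodTerm R p q k ≈ qPoch R (- (p * q)) q k
  prodTerm≈qPoch k = prodOf-cong (upTo k) factor≈
    where
    factor≈ : ∀ j → factorAt (suc j) ≈ 1# - (- (p * q)) * pow R q j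
    factor≈ j = +-congˡ (begin
      p * (q * pow R q j)          ≈⟨ sym (*-assoc p q _) ⟩
      (p * q) * pow R q j          ≈⟨ *-congʳ (sym (-‿involutive _)) ⟩
      (- (- (p * q))) * pow R q j  ≈⟨ sym (-‿distribˡ-* _ _) ⟩
      - ((- (p * q)) * pow R q j)  ∎)

lemma5p1 : {c ℓ : Level} (R : CommutativeRing c ℓ) (n : ℕ) → 1 ≤ n →
    (p q : CommutativeRing.Carrier R) →
    let open CommutativeRing R in
    (BJsum R p q n ≈ subsetSum R p q n
      × subsetSum R p q n ≈ prodTerm R p q n
      × prodTerm R p q n ≈ qPoch R (- (p * q)) q n)
    × (DJsum R p q n ≈ subsetSum R p q (n ∸ 1)
      × subsetSum R p q (n ∸ 1) ≈ prodTerm R p q (n ∸ 1)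
      × prodTerm R p q (n ∸ 1) ≈ qPoch R (- (p * q)) q (n ∸ 1))
lemma5p1 R zero    () p q
lemma5p1 R (suc k) _  p q =
  ( trans (BJsum≈prodTerm (suc k)) (sym (subsetSum≈prodTerm (suc k)))
  , subsetSum≈prodTerm (suc k)
  , prodTerm≈qPoch (suc k) )
  , ( trans (DJsum≈prodTerm k) (sym (subsetSum≈prodTerm k))
    , subsetSum≈prodTerm k
    , prodTerm≈qPoch k )
  where
  open CommutativeRing R
  open WeightedSums R p q
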